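{- For every integer $n\ge 0$, \[ \sum_{k=0}^{n}\binom{n}{k}2^{k}x\,\phi_{k}(x)=\sum_{k=0}^{n}\binom{n}{k}2^{k}(-1)^{n-k}\phi_{k+1}(x). \]
   Context: The Bell polynomials are $\phi_n(x)=\sum_{k=0}^{n}S(n,k)x^k$, where $S(n,k)$ are the Stirling numbers of the second kind. -}

module Defs where

open import Level using (Level)
open import Data.Nat using (ℕ; zero; suc)
import Data.Nat as ℕ
open import Data.Nat.Combinatorics using (_C_)
open import Algebra.Bundles using (CommutativeRing)

S : ℕ → ℕ → ℕ
S zero    zero    = 1
S zero    (suc k) = 0
S (suc n) zero    = 0
S (suc n) (suc k) = suc k ℕ.* S n (suc k) ℕ.+ S n k

module InRing {c ℓ : Level} (R : CommutativeRing c ℓ) where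
  open CommutativeRing R hiding (zero)

  ι : ℕ → Carrier
  ι zero    = 0#
  ι (suc n) = 1# + ι n

  pow : Carrier → ℕ → Carrier
  pow x zero    = 1#
  pow x (suc k) = x * pow x k

  sgn : ℕ → Carrier
  sgn zero    = 1#
  sgn (suc k) = - sgn k

  sumTo : ℕ → (ℕ → Carrier) → Carrier
  sumTo zero    f = f zero
  sumTo (suc n) f = sumTo n f + f (suc n)

  φ : ℕ → Carrier → Carrier
  φ n x = sumTo n (λ k → ι (S n k) * pow x k)

-- Both sides are instances of the binomial transform
--   binom a b f n = Σ_k C(n,k) a^k b^(n-k) f_k,
-- which we define by its Pascal recursion (so that it composes easily) and
-- relate to the closed form sum.  Two transforms compose as
--   binom a b ∘ binom c d = binom (a c) (a d + b),
-- so with (a,b) = (2,1) and (c,d) = (1,-1) the theorem reduces to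
--   x φ_k(x) = binom 1 (-1) (j ↦ φ_(j+1)(x)) k.                        (★)
-- For (★) we view sequences h : ℕ → R under the operator (L h)_i = i h_i + h_(i+1).
-- The Stirling recurrence says Σ_k S(n,k) h_k = (Lⁿ h)_0, so φ_n(x) = (Lⁿ p)_0 for
-- p_i = x^i.  Multiplying by x shifts p, and shifting intertwines L - 1 with L;
-- expanding (L - 1)^k by the binomial theorem for a linear operator plus a scalar
-- gives (★).
module Submission where

open import Defs
open import Level using (Level; _⊔_)
open import Data.Nat using (ℕ; zero; suc; _∸_; _≤_; _<_; z≤n; s≤s)
import Data.Nat as ℕ
open import Data.Nat.Combinatorics using (_C_; k>n⇒nCk≡0; nCk+nC[k+1]≡[n+1]C[k+1])
import Data.Nat.Properties as ℕₚ
open import Algebra.Bundles using (CommutativeRing)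
import Algebra.Solver.Ring.NaturalCoefficients.Default as Solver
import Algebra.Properties.Ring as RingProperties
open import Relation.Binary.PropositionalEquality as ≡ using (_≡_)
import Relation.Binary.Reasoning.Setoid as SetoidReasoning

S-vanish : ∀ n k → n < k → S n k ≡ 0
S-vanish zero    (suc k) _         = ≡.refl
S-vanish (suc n) (suc k) (s≤s n<k)
  rewrite S-vanish n k n<k | S-vanish n (suc k) (ℕₚ.m<n⇒m<1+n n<k) | ℕₚ.*-zeroʳ k = ≡.refl

module BellBinomial {c ℓ : Level} (R : CommutativeRing c ℓ) where
  open CommutativeRing R hiding (zero)
  open InRing R
  open Solver commutativeSemiring using (solve; _:+_; _:*_; _:=_)
  open RingProperties ring using (-1*x≈-x)
  open SetoidReasoning setoid

  Seq : Set c
  Seq = ℕ → Carrier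

  infix 4 _≋_
  _≋_ : Seq → Seq → Set ℓ
  f ≋ g = ∀ i → f i ≈ g i

  comb : Carrier → Seq → Carrier → Seq → Seq
  comb u f v g i = u * f i + v * g i

  sumTo-cong : ∀ n {f g : Seq} → f ≋ g → sumTo n f ≈ sumTo n g
  sumTo-cong zero    f≋g = f≋g 0
  sumTo-cong (suc n) f≋g = +-cong (sumTo-cong n f≋g) (f≋g (suc n))

  sumTo-+ : ∀ n (f g : Seq) → sumTo n (λ k → f k + g k) ≈ sumTo n f + sumTo n g
  sumTo-+ zero    f g = refl
  sumTo-+ (suc n) f g = trans (+-cong (sumTo-+ n f g) refl)
    (solve 4 (λ a b c d → (a :+ b) :+ (c :+ d) := (a :+ c) :+ (b :+ d)) refl _ _ _ _)

  sumTo-* : ∀ n a (f : Seq) → sumTo n (λ k → a * f k) ≈ a * sumTo n f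
  sumTo-* zero    a f = refl
  sumTo-* (suc n) a f = trans (+-cong (sumTo-* n a f) refl) (sym (distribˡ a _ _))

  sumTo-shift : ∀ n (f : Seq) → sumTo (suc n) f ≈ f 0 + sumTo n (λ k → f (suc k))
  sumTo-shift zero    f = refl
  sumTo-shift (suc n) f = trans (+-cong (sumTo-shift n f) refl) (+-assoc _ _ _)

  sumTo-dropLast : ∀ n {f : Seq} → f (suc n) ≈ 0# → sumTo (suc n) f ≈ sumTo n f
  sumTo-dropLast n fn≈0 = trans (+-cong refl fn≈0) (+-identityʳ _)

  sumTo-dropFirst : ∀ n {f : Seq} → f 0 ≈ 0# → sumTo (suc n) f ≈ sumTo n (λ k → f (suc k))
  sumTo-dropFirst n {f} f0≈0 =
    trans (sumTo-shift n f) (trans (+-cong f0≈0 refl) (+-identityˡ _))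

  sumTo-reindex : ∀ n {f : Seq} → f 0 ≈ 0# → f (suc n) ≈ 0# →
                  sumTo n (λ k → f (suc k)) ≈ sumTo n f
  sumTo-reindex n f0≈0 fn≈0 = trans (sym (sumTo-dropFirst n f0≈0)) (sumTo-dropLast n fn≈0)

  ι-+ : ∀ a b → ι (a ℕ.+ b) ≈ ι a + ι b
  ι-+ zero    b = sym (+-identityˡ _)
  ι-+ (suc a) b = trans (+-cong refl (ι-+ a b)) (sym (+-assoc _ _ _))

  ι-* : ∀ a b → ι (a ℕ.* b) ≈ ι a * ι b
  ι-* zero    b = sym (zeroˡ _)
  ι-* (suc a) b = trans (ι-+ b (a ℕ.* b)) (trans (+-cong refl (ι-* a b))
    (sym (trans (distribʳ _ _ _) (+-cong (*-identityˡ _) refl))))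

  ι-zero : ∀ {n} → n ≡ 0 → ι n ≈ 0#
  ι-zero ≡.refl = refl

  pow-one : ∀ j → pow 1# j ≈ 1#
  pow-one zero    = refl
  pow-one (suc j) = trans (*-identityˡ _) (pow-one j)

  sgn≈pow : ∀ j → sgn j ≈ pow (- 1#) j
  sgn≈pow zero    = refl
  sgn≈pow (suc j) = trans (-‿cong (sgn≈pow j)) (sym (-1*x≈-x _))

  -- b^(n-k) = b · b^(n-k-1) under truncated subtraction, provided the
  -- coefficient c in front vanishes in the degenerate range n ≤ k.
  pow-∸-step : ∀ b n k (c : Carrier) → (n ≤ k → c ≈ 0#) →
               c * pow b (n ∸ k) ≈ c * (b * pow b (n ∸ suc k))
  pow-∸-step b zero    k       c c≈0 = trans (*-cong (c≈0 z≤n) refl)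
    (trans (zeroˡ _) (sym (trans (*-cong (c≈0 z≤n) refl) (zeroˡ _))))
  pow-∸-step b (suc n) zero    c c≈0 = refl
  pow-∸-step b (suc n) (suc k) c c≈0 = pow-∸-step b n k c (λ n≤k → c≈0 (s≤s n≤k))

  binom : Carrier → Carrier → Seq → ℕ → Carrier
  binom a b f zero    = f 0
  binom a b f (suc n) = b * binom a b f n + a * binom a b (λ k → f (suc k)) n

  binom-cong : ∀ {a a′ b b′} → a ≈ a′ → b ≈ b′ → ∀ n {f g : Seq} → f ≋ g →
               binom a b f n ≈ binom a′ b′ g n
  binom-cong a≈ b≈ zero    f≋g = f≋g 0
  binom-cong a≈ b≈ (suc n) f≋g =
    +-cong (*-cong b≈ (binom-cong a≈ b≈ n f≋g)) (*-cong a≈ (binom-cong a≈ b≈ n (λ i → f≋g (suc i))))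

  binom-linear : ∀ a b u v n {w f g : Seq} → w ≋ comb u f v g →
                 binom a b w n ≈ u * binom a b f n + v * binom a b g n
  binom-linear a b u v zero    w≋ = w≋ 0
  binom-linear a b u v (suc n) {w} {f} {g} w≋ =
    trans (+-cong (*-cong refl (binom-linear a b u v n w≋))
                  (*-cong refl (binom-linear a b u v n (λ i → w≋ (suc i)))))
      (solve 8 (λ a b u v x y x′ y′ → (b :* ((u :* x) :+ (v :* y))) :+ (a :* ((u :* x′) :+ (v :* y′)))
                  := (u :* ((b :* x) :+ (a :* x′))) :+ (v :* ((b :* y) :+ (a :* y′)))) refl
        a b u v (binom a b f n) (binom a b g n)
        (binom a b (λ k → f (suc k)) n) (binom a b (λ k → g (suc k)) n))

  -- Composition of binomial transforms; the inner transform satisfies Pascal's rule,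
  -- so by linearity the outer recursion absorbs it with parameters (a c, a d + b).
  binom-compose : ∀ a b c d n (f : Seq) →
                  binom a b (binom c d f) n ≈ binom (a * c) (a * d + b) f n
  binom-compose a b c d zero    f = refl
  binom-compose a b c d (suc n) f =
    trans (+-cong (*-cong refl (binom-compose a b c d n f))
                  (*-cong refl (trans (binom-linear a b d c n (λ i → refl))
                     (+-cong (*-cong refl (binom-compose a b c d n f))
                             (*-cong refl (binom-compose a b c d n (λ k → f (suc k))))))))
      (solve 6 (λ a b c d X Y → (b :* X) :+ (a :* ((d :* X) :+ (c :* Y)))
                  := (((a :* d) :+ b) :* X) :+ ((a :* c) :* Y)) refl
        a b c d (binom (a * c) (a * d + b) f n) (binom (a * c) (a * d + b) (λ k → f (suc k)) n))

  module ClosedForm (a b : Carrier) where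

    term : ℕ → Seq → Seq
    term n f k = ι (n C k) * pow a k * pow b (n ∸ k) * f k

    term-last : ∀ n f → term n f (suc n) ≈ 0#
    term-last n f = trans (*-cong (*-cong (*-cong (ι-zero (k>n⇒nCk≡0 (ℕₚ.n<1+n n))) refl) refl) refl)
      (trans (*-cong (*-cong (zeroˡ _) refl) refl) (trans (*-cong (zeroˡ _) refl) (zeroˡ _)))

    term-first : ∀ n f → term (suc n) f 0 ≈ b * term n f 0
    term-first n f = solve 5 (λ i o b q y → ((i :* o) :* (b :* q)) :* y := b :* (((i :* o) :* q) :* y))
      refl (ι (n C 0)) 1# b (pow b n) (f 0)

    term-pascal : ∀ n f k → term (suc n) f (suc k) ≈ a * term n (λ j → f (suc j)) k + b * term n f (suc k)
    term-pascal n f k = begin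
        ι (suc n C suc k) * (a * pow a k) * pow b (n ∸ k) * f (suc k)
      ≈⟨ *-cong (*-cong (*-cong ι-pascal refl) refl) refl ⟩
        (ι (n C k) + ι (n C suc k)) * (a * pow a k) * pow b (n ∸ k) * f (suc k)
      ≈⟨ solve 6 (λ a A B p q y → (((A :+ B) :* (a :* p)) :* q) :* y
                    := (a :* (((A :* p) :* q) :* y)) :+ ((B :* q) :* ((a :* p) :* y))) refl
           a (ι (n C k)) (ι (n C suc k)) (pow a k) (pow b (n ∸ k)) (f (suc k)) ⟩
        a * term n (λ j → f (suc j)) k + ι (n C suc k) * pow b (n ∸ k) * (a * pow a k * f (suc k))
      ≈⟨ +-cong refl (*-cong (pow-∸-step b n k _ (λ n≤k → ι-zero (k>n⇒nCk≡0 (s≤s n≤k)))) refl) ⟩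
        a * term n (λ j → f (suc j)) k + ι (n C suc k) * (b * pow b (n ∸ suc k)) * (a * pow a k * f (suc k))
      ≈⟨ +-cong refl (solve 6 (λ B b q a p y → (B :* (b :* q)) :* ((a :* p) :* y)
                                 := b :* (((B :* (a :* p)) :* q) :* y)) refl
           (ι (n C suc k)) b (pow b (n ∸ suc k)) a (pow a k) (f (suc k))) ⟩
        a * term n (λ j → f (suc j)) k + b * term n f (suc k)
      ∎
      where
      ι-pascal : ι (suc n C suc k) ≈ ι (n C k) + ι (n C suc k)
      ι-pascal = trans (reflexive (≡.cong ι (≡.sym (nCk+nC[k+1]≡[n+1]C[k+1] n k)))) (ι-+ (n C k) (n C suc k))

    sum-pascal : ∀ n f → sumTo (suc n) (term (suc n) f)
                       ≈ b * sumTo n (term n f) + a * sumTo n (term n (λ k → f (suc k)))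
    sum-pascal n f = begin
        sumTo (suc n) (term (suc n) f)
      ≈⟨ sumTo-shift n _ ⟩
        term (suc n) f 0 + sumTo n (λ k → term (suc n) f (suc k))
      ≈⟨ +-cong (term-first n f) (sumTo-cong n (term-pascal n f)) ⟩
        b * term n f 0 + sumTo n (λ k → a * term n f′ k + b * term n f (suc k))
      ≈⟨ +-cong refl (trans (sumTo-+ n _ _) (+-cong (sumTo-* n a _) (sumTo-* n b _))) ⟩
        b * term n f 0 + (a * sumTo n (term n f′) + b * sumTo n (λ k → term n f (suc k)))
      ≈⟨ solve 5 (λ a b t X Y → (b :* t) :+ ((a :* X) :+ (b :* Y)) := (b :* (t :+ Y)) :+ (a :* X)) refl
           a b _ _ _ ⟩
        b * (term n f 0 + sumTo n (λ k → term n f (suc k))) + a * sumTo n (term n f′)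
      ≈⟨ +-cong (*-cong refl (trans (sym (sumTo-shift n _)) (sumTo-dropLast n (term-last n f)))) refl ⟩
        b * sumTo n (term n f) + a * sumTo n (term n f′)
      ∎
      where
      f′ : Seq
      f′ k = f (suc k)

    binom-closed : ∀ n f → sumTo n (term n f) ≈ binom a b f n
    binom-closed zero    f =
      trans (*-cong (trans (*-identityʳ _) (trans (*-identityʳ _) (+-identityʳ 1#))) refl) (*-identityˡ _)
    binom-closed (suc n) f = trans (sum-pascal n f)
      (+-cong (*-cong refl (binom-closed n f)) (*-cong refl (binom-closed n (λ k → f (suc k)))))

  iter : (Seq → Seq) → ℕ → Seq → Seq
  iter T zero    h = h
  iter T (suc k) h = iter T k (T h)

  iter-comm : ∀ T k h → iter T k (T h) ≡ T (iter T k h)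
  iter-comm T zero    h = ≡.refl
  iter-comm T (suc k) h = iter-comm T k (T h)

  -- Linearity, including compatibility with pointwise equality.
  Linear : (Seq → Seq) → Set (c ⊔ ℓ)
  Linear T = ∀ u v {w f g : Seq} → w ≋ comb u f v g → T w ≋ comb u (T f) v (T g)

  iter-linear : ∀ {T} → Linear T → ∀ k → Linear (iter T k)
  iter-linear lin zero    u v w≋ = w≋
  iter-linear lin (suc k) u v w≋ = iter-linear lin k u v (lin u v w≋)

  iter-cong : ∀ {T} → Linear T → ∀ k {f g : Seq} → f ≋ g → iter T k f ≋ iter T k g
  iter-cong lin k {f} {g} f≋g i =
    trans (iter-linear lin k 1# 0# (λ j → trans (f≋g j) (sym (unit (g j)))) i) (unit _)
    where
    unit : ∀ y → 1# * y + 0# * y ≈ y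
    unit y = trans (+-cong (*-identityˡ y) (zeroˡ y)) (+-identityʳ y)

  iter-scale : ∀ {T} → Linear T → ∀ k u (f : Seq) → iter T k (λ j → u * f j) ≋ λ i → u * iter T k f i
  iter-scale lin k u f i =
    trans (iter-linear lin k u 0# (λ j → sym (pad (f j))) i) (pad _)
    where
    pad : ∀ y → u * y + 0# * y ≈ u * y
    pad y = trans (+-cong refl (zeroˡ y)) (+-identityʳ _)

  _⊕_ : (Seq → Seq) → Carrier → Seq → Seq
  (T ⊕ c) h i = T h i + c * h i

  ⊕-linear : ∀ {T} c → Linear T → Linear (T ⊕ c)
  ⊕-linear {T} c lin u v {w} {f} {g} w≋ i = trans (+-cong (lin u v w≋ i) (*-cong refl (w≋ i)))
    (solve 7 (λ c u v x y X Y → ((u :* X) :+ (v :* Y)) :+ (c :* ((u :* x) :+ (v :* y)))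
                := (u :* (X :+ (c :* x))) :+ (v :* (Y :+ (c :* y)))) refl
      c u v (f i) (g i) (T f i) (T g i))

  binomial-operator : ∀ {T} c → Linear T → ∀ k (h : Seq) i →
                      iter (T ⊕ c) k h i ≈ binom 1# c (λ j → iter T j h i) k
  binomial-operator c lin zero    h i = refl
  binomial-operator {T} c lin (suc k) h i = sym (begin
      c * binom 1# c (λ j → iter T j h i) k + 1# * binom 1# c (λ j → iter T j (T h) i) k
    ≈⟨ +-cong (*-cong refl (sym (binomial-operator c lin k h i)))
              (*-cong refl (sym (binomial-operator c lin k (T h) i))) ⟩
      c * iter (T ⊕ c) k h i + 1# * iter (T ⊕ c) k (T h) i
    ≈⟨ +-comm _ _ ⟩
      1# * iter (T ⊕ c) k (T h) i + c * iter (T ⊕ c) k h i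
    ≈⟨ sym (iter-linear (⊕-linear c lin) k 1# c (λ j → +-cong (sym (*-identityˡ _)) refl) i) ⟩
      iter (T ⊕ c) k ((T ⊕ c) h) i
    ∎)

  L : Seq → Seq
  L h i = ι i * h i + h (suc i)

  L-linear : Linear L
  L-linear u v {w} {f} {g} w≋ i = trans (+-cong (*-cong refl (w≋ i)) (w≋ (suc i)))
    (solve 7 (λ I u v x y x′ y′ → (I :* ((u :* x) :+ (v :* y))) :+ ((u :* x′) :+ (v :* y′))
                := (u :* ((I :* x) :+ x′)) :+ (v :* ((I :* y) :+ y′))) refl
      (ι i) u v (f i) (g i) (f (suc i)) (g (suc i)))

  shift-L : ∀ (h : Seq) j → (L ⊕ (- 1#)) h (suc j) ≈ L (λ i → h (suc i)) j
  shift-L h j = trans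
    (solve 5 (λ o I a b m → (((o :+ I) :* a) :+ b) :+ (m :* a) := ((I :* a) :+ b) :+ ((o :+ m) :* a)) refl
      1# (ι j) (h (suc j)) (h (suc (suc j))) (- 1#))
    (trans (+-cong refl (trans (*-cong (-‿inverseʳ 1#) refl) (zeroˡ _))) (+-identityʳ _))

  shift-iter : ∀ k (h : Seq) i → iter (L ⊕ (- 1#)) k h (suc i) ≈ iter L k (λ j → h (suc j)) i
  shift-iter zero    h i = refl
  shift-iter (suc k) h i = trans (shift-iter k _ i) (iter-cong L-linear k (shift-L h) i)

  stirling : ℕ → Seq → Carrier
  stirling n h = sumTo n (λ k → ι (S n k) * h k)

  -- The recurrence for S(n,k) makes the Stirling sums iterate L.
  stirling-step : ∀ n h → stirling (suc n) h ≈ stirling n (L h)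
  stirling-step n h = begin
      stirling (suc n) h
    ≈⟨ sumTo-dropFirst n (zeroˡ _) ⟩
      sumTo n (λ k → ι (S (suc n) (suc k)) * h (suc k))
    ≈⟨ sumTo-cong n recurrence ⟩
      sumTo n (λ k → ι (S n (suc k)) * (ι (suc k) * h (suc k)) + ι (S n k) * h (suc k))
    ≈⟨ sumTo-+ n _ _ ⟩
      sumTo n (λ k → ι (S n (suc k)) * (ι (suc k) * h (suc k))) + sumTo n (λ k → ι (S n k) * h (suc k))
    ≈⟨ +-cong (sumTo-reindex n (trans (*-cong refl (zeroˡ _)) (zeroʳ _)) vanish) refl ⟩
      sumTo n (λ k → ι (S n k) * (ι k * h k)) + sumTo n (λ k → ι (S n k) * h (suc k))
    ≈⟨ sym (sumTo-+ n _ _) ⟩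
      sumTo n (λ k → ι (S n k) * (ι k * h k) + ι (S n k) * h (suc k))
    ≈⟨ sumTo-cong n (λ k → sym (distribˡ _ _ _)) ⟩
      stirling n (L h)
    ∎
    where
    recurrence : ∀ k → ι (S (suc n) (suc k)) * h (suc k)
                       ≈ ι (S n (suc k)) * (ι (suc k) * h (suc k)) + ι (S n k) * h (suc k)
    recurrence k =
      trans (*-cong (trans (ι-+ (suc k ℕ.* S n (suc k)) (S n k)) (+-cong (ι-* (suc k) (S n (suc k))) refl)) refl)
        (solve 4 (λ a b c y → ((a :* b) :+ c) :* y := (b :* (a :* y)) :+ (c :* y)) refl _ _ _ _)
    vanish : ι (S n (suc n)) * (ι (suc n) * h (suc n)) ≈ 0#
    vanish = trans (*-cong (ι-zero (S-vanish n (suc n) (ℕₚ.n<1+n n))) refl) (zeroˡ _)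

  stirling-iterate : ∀ n h → stirling n h ≈ iter L n h 0
  stirling-iterate zero    h = trans (*-cong (+-identityʳ 1#) refl) (*-identityˡ _)
  stirling-iterate (suc n) h = trans (stirling-step n h) (stirling-iterate n (L h))

  module _ (x : Carrier) where

    bell-suc : ∀ j → φ (suc j) x ≈ iter L j (pow x) 1
    bell-suc j = begin
        φ (suc j) x
      ≈⟨ stirling-iterate (suc j) (pow x) ⟩
        iter L j (L (pow x)) 0
      ≡⟨ ≡.cong (λ h → h 0) (iter-comm L j (pow x)) ⟩
        0# * iter L j (pow x) 0 + iter L j (pow x) 1
      ≈⟨ trans (+-cong (zeroˡ _) refl) (+-identityˡ _) ⟩
        iter L j (pow x) 1
      ∎

    x-bell : ∀ k → x * φ k x ≈ binom 1# (- 1#) (λ j → φ (suc j) x) k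
    x-bell k = begin
        x * φ k x
      ≈⟨ *-cong refl (stirling-iterate k (pow x)) ⟩
        x * iter L k (pow x) 0
      ≈⟨ sym (iter-scale L-linear k x (pow x) 0) ⟩
        iter L k (λ i → pow x (suc i)) 0
      ≈⟨ sym (shift-iter k (pow x) 0) ⟩
        iter (L ⊕ (- 1#)) k (pow x) 1
      ≈⟨ binomial-operator (- 1#) L-linear k (pow x) 1 ⟩
        binom 1# (- 1#) (λ j → iter L j (pow x) 1) k
      ≈⟨ binom-cong refl refl k (λ j → sym (bell-suc j)) ⟩
        binom 1# (- 1#) (λ j → φ (suc j) x) k
      ∎

  two-minus-one : ι 2 * (- 1#) + 1# ≈ - 1#
  two-minus-one = begin
      (1# + (1# + 0#)) * (- 1#) + 1#
    ≈⟨ +-cong (*-cong (+-cong refl (+-identityʳ 1#)) refl) refl ⟩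
      (1# + 1#) * (- 1#) + 1#
    ≈⟨ +-cong (trans (distribʳ _ 1# 1#) (+-cong (*-identityˡ _) (*-identityˡ _))) refl ⟩
      (- 1#) + (- 1#) + 1#
    ≈⟨ trans (+-assoc _ _ _) (+-cong refl (-‿inverseˡ 1#)) ⟩
      (- 1#) + 0#
    ≈⟨ +-identityʳ _ ⟩
      - 1#
    ∎

  -- Both sides are closed forms of binomial transforms related by (★) and composition.
  theorem : ∀ n x → sumTo n (λ k → ι (n C k) * pow (ι 2) k * x * φ k x)
                    ≈ sumTo n (λ k → ι (n C k) * pow (ι 2) k * sgn (n ∸ k) * φ (suc k) x)
  theorem n x = begin
      sumTo n (λ k → ι (n C k) * pow (ι 2) k * x * φ k x)
    ≈⟨ sumTo-cong n (λ k → insert-one (pow-one (n ∸ k))) ⟩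
      sumTo n (term (ι 2) 1# n (λ k → x * φ k x))
    ≈⟨ binom-closed (ι 2) 1# n _ ⟩
      binom (ι 2) 1# (λ k → x * φ k x) n
    ≈⟨ binom-cong refl refl n (x-bell x) ⟩
      binom (ι 2) 1# (binom 1# (- 1#) F) n
    ≈⟨ binom-compose (ι 2) 1# 1# (- 1#) n F ⟩
      binom (ι 2 * 1#) (ι 2 * (- 1#) + 1#) F n
    ≈⟨ binom-cong (*-identityʳ _) two-minus-one n (λ _ → refl) ⟩
      binom (ι 2) (- 1#) F n
    ≈⟨ sym (binom-closed (ι 2) (- 1#) n F) ⟩
      sumTo n (term (ι 2) (- 1#) n F)
    ≈⟨ sumTo-cong n (λ k → *-cong (*-cong refl (sym (sgn≈pow (n ∸ k)))) refl) ⟩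
      sumTo n (λ k → ι (n C k) * pow (ι 2) k * sgn (n ∸ k) * φ (suc k) x)
    ∎
    where
    open ClosedForm using (term; binom-closed)
    F : Seq
    F j = φ (suc j) x
    insert-one : ∀ {A P y z W} → W ≈ 1# → A * P * y * z ≈ A * P * W * (y * z)
    insert-one W≈1 = trans (*-assoc _ _ _)
      (sym (trans (*-cong (*-cong refl W≈1) refl) (*-cong (*-identityʳ _) refl)))

mainTheorem6 : {c ℓ : Level} (R : CommutativeRing c ℓ) →
    let open CommutativeRing R hiding (zero)
        open InRing R
    in (n : ℕ) (x : Carrier) →
       sumTo n (λ k → ι (n C k) * pow (ι 2) k * x * φ k x)
         ≈ sumTo n (λ k → ι (n C k) * pow (ι 2) k * sgn (n ∸ k) * φ (ℕ.suc k) x)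
mainTheorem6 R = BellBinomial.theorem R
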